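{- Let $H$ be a graph with no chorded cycle. Let $U$ and $W$ be two vertex-disjoint paths in $H$, and let $u_1, u_2$ be the endpoints of $U$ (possibly $u_1 = u_2$ if $U$ has one vertex). Then $\|\{u_1,u_2\}, W\| \leq 3$. If equality holds, then $u_1 \neq u_2$, and for some $i \in \{1,2\}$ we have $\|u_i, W\| = 2$ and $\|u_{3-i}, W\| = 1$, with the neighbor of $u_{3-i}$ on $W$ lying strictly between the two neighbors of $u_i$ along $W$; moreover $\|V(U), V(W)\| = 3$.
   Context: All graphs are finite and simple. A chorded cycle is a cycle together with at least one edge of the graph joining two non-consecutive vertices of the cycle. For $A, B \subseteq V(H)$ (not necessarily disjoint), $\|A,B\| := \sum_{a \in A} |N_H(a) \cap B|$; a single vertex $a$ or a subgraph is identified with $\{a\}$ or its vertex set in this notation. -}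

module Defs where

open import Data.Nat using (ℕ; zero; suc; _<_)
import Data.Nat
open import Data.Bool using (Bool; true; false; _∧_; _∨_; if_then_else_)
open import Data.Fin using (Fin; toℕ; _≟_)
open import Data.List using (List; []; _∷_; length; lookup; map; allFin)
open import Data.Bool.ListAction using (any)
open import Data.Nat.ListAction using (sum)
open import Data.Sum using (_⊎_)
open import Data.List.Relation.Unary.Linked using (Linked)
open import Data.List.Relation.Unary.Unique.Propositional using (Unique)
open import Data.Product using (Σ; _×_; ∃)
open import Relation.Nullary using (¬_)
open import Relation.Nullary.Decidable using (⌊_⌋)
open import Relation.Binary.PropositionalEquality using (_≡_)

record Graph (n : ℕ) : Set where
  field
    adj    : Fin n → Fin n → Bool
    sym    : ∀ u v → adj u v ≡ adj v u
    irrefl : ∀ v → adj v v ≡ false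
open Graph public

Edge : ∀ {n} → Graph n → Fin n → Fin n → Set
Edge G u v = adj G u v ≡ true

VSet : ℕ → Set
VSet n = Fin n → Bool

single : ∀ {n} → Fin n → VSet n
single a v = ⌊ v ≟ a ⌋

pair : ∀ {n} → Fin n → Fin n → VSet n
pair a b v = ⌊ v ≟ a ⌋ ∨ ⌊ v ≟ b ⌋

vset : ∀ {n} → List (Fin n) → VSet n
vset xs v = any (λ w → ⌊ v ≟ w ⌋) xs

‖_,_‖⟨_⟩ : ∀ {n} → VSet n → VSet n → Graph n → ℕ
‖_,_‖⟨_⟩ {n} A B G =
  sum (map (λ a → sum (map (λ b → if A a ∧ B b ∧ adj G a b then 1 else 0) (allFin n))) (allFin n))

record IsPath {n} (G : Graph n) (P : List (Fin n)) : Set where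
  field
    nonempty : ¬ (P ≡ [])
    distinct : Unique P
    linked   : Linked (Edge G) P

CycConsec : ℕ → ℕ → ℕ → Set
CycConsec k i j = (j ≡ suc i) ⊎ (i ≡ suc j) ⊎ ((i ≡ 0) × (suc j ≡ k)) ⊎ ((j ≡ 0) × (suc i ≡ k))

record IsCycle {n} (G : Graph n) (C : List (Fin n)) : Set where
  field
    long     : 3 Data.Nat.≤ length C
    distinct : Unique C
    linked   : Linked (Edge G) C
    closing  : Σ (Fin (length C)) λ f → Σ (Fin (length C)) λ l →
               (toℕ f ≡ 0) × (suc (toℕ l) ≡ length C) × Edge G (lookup C l) (lookup C f)

ChordedCycle : ∀ {n} → Graph n → Set
ChordedCycle {n} G = Σ (List (Fin n)) λ C → IsCycle G C ×
  Σ (Fin (length C)) λ i → Σ (Fin (length C)) λ j →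
    ¬ (i ≡ j) × ¬ CycConsec (length C) (toℕ i) (toℕ j) × Edge G (lookup C i) (lookup C j)

Straddle : ∀ {n} → Graph n → Fin n → Fin n → List (Fin n) → Set
Straddle G a b W =
  (‖ single a , vset W ‖⟨ G ⟩ ≡ 2) × (‖ single b , vset W ‖⟨ G ⟩ ≡ 1) ×
  Σ (Fin (length W)) λ j → Σ (Fin (length W)) λ k → Σ (Fin (length W)) λ l →
    (toℕ j < toℕ k) × (toℕ k < toℕ l) ×
    Edge G a (lookup W j) × Edge G b (lookup W k) × Edge G a (lookup W l)

module Submission where

-- Everything rests on the fan lemma: a vertex h off a path P, adjacent to both ends of P and to
-- an inner vertex y, closes the cycle h P h, in which h–y is a chord.  Writing deg a W for the
-- number of neighbours of a on W and U = x ∷ T for a path from x to y, it gives in turn: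
--   * deg a W ≤ 2 for a off W (fan on W between the first and third neighbour of a);
--   * if x sees p before q on W, every vertex of T sees W only strictly between p and q
--     (fan for x on p … q … d followed by the way back along U to the successor of x);
--   * hence x and y do not both see W twice, so deg x W + deg y W ≤ 3;
--   * if deg x W = 2 and deg y W = 1, y seeing w between p and q, the inner vertices of U see
--     nothing on W (fan for an inner vertex of the cycle U w … q x).

open import Defs hiding (sym)
open import Data.Nat using (ℕ; suc; _+_; _≤_; _<_; z≤n; s≤s)
open import Data.Nat.Properties
  using (+-commutativeSemigroup; +-identityʳ; +-comm; +-suc; suc-injective; m+1+n≢m; m<m+n; ≤-refl; m≤n⇒m≤1+n)
open import Algebra.Properties.CommutativeSemigroup +-commutativeSemigroup
  using () renaming (interchange to +-interchange)
open import Data.Bool using (true; false; _∧_; _∨_; if_then_else_)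
open import Data.Bool.Properties using (∨-identityʳ; ∨-idem)
open import Data.Fin using (Fin; toℕ; _≟_) renaming (zero to fzero; suc to fsuc)
open import Data.List using (List; []; _∷_; _++_; reverse; head; last; length; lookup; map; allFin)
open import Data.List.Properties
  using (++-assoc; unfold-reverse; reverse-++; reverse-involutive; length-++; map-cong; map-++)
open import Data.List.Membership.Propositional using (_∈_; _∉_)
open import Data.List.Membership.Propositional.Properties using (∈-++⁺ˡ; ∈-++⁺ʳ; ∈-++⁻; ∈-∃++; ∈-allFin)
open import Data.List.Relation.Unary.Any using (here; there)
open import Data.List.Relation.Unary.Any.Properties
  using () renaming (reverse⁺ to ∈-reverse⁺; reverse⁻ to ∈-reverse⁻)
open import Data.List.Relation.Unary.All using ([]; _∷_)
open import Data.List.Relation.Unary.All.Properties using (All¬⇒¬Any; ¬Any⇒All¬; ++⁻ˡ)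
open import Data.List.Relation.Unary.AllPairs using ([]; _∷_)
open import Data.List.Relation.Unary.Unique.Propositional using (Unique)
open import Data.List.Relation.Unary.Unique.Propositional.Properties using (Unique[x∷xs]⇒x∉xs)
import Data.List.Relation.Unary.Unique.Propositional.Properties as Unique
open import Data.List.Relation.Unary.Linked using (Linked; []; [-]; _∷_)
import Data.List.Relation.Unary.Linked.Properties as Linked
open import Data.List.Relation.Binary.Disjoint.Propositional using (Disjoint)
open import Data.Maybe using (just)
open import Data.Maybe.Properties using (just-injective)
open import Data.Maybe.Relation.Binary.Connected using (Connected; just)
open import Data.Nat.ListAction using (sum)
open import Data.Nat.ListAction.Properties using (sum-++)
open import Data.Product using (Σ; ∃; ∃₂; _×_; _,_; proj₁; proj₂)
open import Data.Sum using (_⊎_; inj₁; inj₂)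
open import Data.Empty using (⊥; ⊥-elim)
open import Function using (_∘_)
open import Relation.Nullary using (¬_; yes; no)
open import Relation.Nullary.Decidable using (⌊_⌋)
open import Relation.Binary.PropositionalEquality
  using (_≡_; _≢_; refl; sym; trans; cong; cong₂; subst; subst₂; module ≡-Reasoning)

module _ {A : Set} where

  last-++ : ∀ (xs : List A) {ys} → ys ≢ [] → last (xs ++ ys) ≡ last ys
  last-++ []            ys≢[]          = refl
  last-++ (x ∷ [])      {[]}     ys≢[] = ⊥-elim (ys≢[] refl)
  last-++ (x ∷ [])      {y ∷ ys} ys≢[] = refl
  last-++ (x ∷ x′ ∷ xs) ys≢[]          = last-++ (x′ ∷ xs) ys≢[]

  last-reverse : ∀ (xs : List A) → last (reverse xs) ≡ head xs
  last-reverse []       = refl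
  last-reverse (x ∷ xs) rewrite unfold-reverse x xs = last-++ (reverse xs) (λ ())

  head-reverse : ∀ (xs : List A) → head (reverse xs) ≡ last xs
  head-reverse xs = trans (sym (last-reverse (reverse xs))) (cong last (reverse-involutive xs))

  last∈ : ∀ {xs : List A} {r} → last xs ≡ just r → r ∈ xs
  last∈ {x ∷ []}      refl = here refl
  last∈ {x ∷ x′ ∷ xs} eq   = there (last∈ {x′ ∷ xs} eq)

  head-++ : ∀ (xs : List A) {y ys zs} → head (xs ++ y ∷ ys) ≡ head (xs ++ y ∷ zs)
  head-++ []       = refl
  head-++ (x ∷ xs) = refl

  reverse-split : ∀ (xs : List A) v ys → reverse (xs ++ v ∷ ys) ≡ reverse ys ++ v ∷ reverse xs
  reverse-split xs v ys = begin
    reverse (xs ++ v ∷ ys)               ≡⟨ reverse-++ xs (v ∷ ys) ⟩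
    reverse (v ∷ ys) ++ reverse xs       ≡⟨ cong (_++ reverse xs) (unfold-reverse v ys) ⟩
    (reverse ys ++ v ∷ []) ++ reverse xs ≡⟨ ++-assoc (reverse ys) (v ∷ []) (reverse xs) ⟩
    reverse ys ++ v ∷ reverse xs         ∎
    where open ≡-Reasoning

  reverse-split₂ : ∀ (xs : List A) v ys w zs →
                   reverse (xs ++ v ∷ ys ++ w ∷ zs) ≡ reverse zs ++ w ∷ reverse ys ++ v ∷ reverse xs
  reverse-split₂ xs v ys w zs = begin
    reverse (xs ++ v ∷ ys ++ w ∷ zs)                  ≡⟨ reverse-split xs v (ys ++ w ∷ zs) ⟩
    reverse (ys ++ w ∷ zs) ++ v ∷ reverse xs          ≡⟨ cong (_++ v ∷ reverse xs) (reverse-split ys w zs) ⟩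
    (reverse zs ++ w ∷ reverse ys) ++ v ∷ reverse xs  ≡⟨ ++-assoc (reverse zs) (w ∷ reverse ys) (v ∷ reverse xs) ⟩
    reverse zs ++ w ∷ reverse ys ++ v ∷ reverse xs    ∎
    where open ≡-Reasoning

  position : ∀ {xs : List A} ys v zs → xs ≡ ys ++ v ∷ zs →
             Σ (Fin (length xs)) λ i → (toℕ i ≡ length ys) × (lookup xs i ≡ v)
  position ys v zs refl = go ys
    where
    go : ∀ ys → Σ (Fin (length (ys ++ v ∷ zs))) λ i → (toℕ i ≡ length ys) × (lookup (ys ++ v ∷ zs) i ≡ v)
    go []       = fzero , refl , refl
    go (y ∷ ys) with go ys
    ... | i , i≡ , v≡ = fsuc i , cong suc i≡ , v≡

  last-position : ∀ (xs : List A) {b} → last xs ≡ just b →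
                  Σ (Fin (length xs)) λ l → (suc (toℕ l) ≡ length xs) × (lookup xs l ≡ b)
  last-position (x ∷ [])      refl = fzero , refl , refl
  last-position (x ∷ x′ ∷ xs) eq with last-position (x′ ∷ xs) eq
  ... | l , l-last , lookup≡b = fsuc l , cong suc l-last , lookup≡b

  last-exists : ∀ (x : A) xs → ∃ λ r → last (x ∷ xs) ≡ just r
  last-exists x []        = x , refl
  last-exists x (x′ ∷ xs) = last-exists x′ xs

  interior-split : ∀ {T : List A} {z y} → z ∈ T → last T ≡ just y → z ≢ y →
                   ∃₂ λ X u → ∃ λ V → (T ≡ X ++ z ∷ u ∷ V) × (last (u ∷ V) ≡ just y)
  interior-split z∈T last≡y z≢y with ∈-∃++ z∈T
  ... | X , [] , refl    = ⊥-elim (z≢y (just-injective (trans (sym (last-++ X (λ ()))) last≡y)))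
  ... | X , u ∷ V , refl = X , u , V , refl , trans (sym (last-++ X (λ ()))) last≡y

  head∈ : ∀ {xs : List A} {a} → head xs ≡ just a → a ∈ xs
  head∈ {x ∷ xs} refl = here refl

  head⇒≢[] : ∀ {xs : List A} {a} → head xs ≡ just a → xs ≢ []
  head⇒≢[] {x ∷ xs} _ ()

  up-to : ∀ {q d : A} {C} → d ∈ q ∷ C → ∃₂ λ C₁ C₂ → (C ≡ C₁ ++ C₂) × (last (q ∷ C₁) ≡ just d)
  up-to (here refl) = [] , _ , refl , refl
  up-to {q} {d} (there d∈C) with ∈-∃++ d∈C
  ... | C₁ , C₂ , refl = C₁ ++ d ∷ [] , C₂ , sym (++-assoc C₁ (d ∷ []) C₂) , last-++ (q ∷ C₁) (λ ())

  length-< : ∀ (xs : List A) {v ys} → length xs < length (xs ++ v ∷ ys)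
  length-< xs = subst (length xs <_) (sym (length-++ xs)) (m<m+n (length xs) (s≤s z≤n))

  ordered-positions : ∀ {xs : List A} ys p ys₁ w ys₂ q zs → xs ≡ ys ++ p ∷ (ys₁ ++ w ∷ ys₂) ++ q ∷ zs →
    Σ (Fin (length xs)) λ j → Σ (Fin (length xs)) λ k → Σ (Fin (length xs)) λ l →
      (toℕ j < toℕ k) × (toℕ k < toℕ l) × (lookup xs j ≡ p) × (lookup xs k ≡ w) × (lookup xs l ≡ q)
  ordered-positions ys p ys₁ w ys₂ q zs refl =
    j , k , l , j<k , k<l , proj₂ (proj₂ at-p) , proj₂ (proj₂ at-w) , proj₂ (proj₂ at-q)
    where
    at-p = position ys p ((ys₁ ++ w ∷ ys₂) ++ q ∷ zs) refl
    at-w = position (ys ++ p ∷ ys₁) w (ys₂ ++ q ∷ zs)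
             (trans (cong (λ t → ys ++ p ∷ t) (++-assoc ys₁ (w ∷ ys₂) (q ∷ zs))) (sym (++-assoc ys (p ∷ ys₁) _)))
    at-q = position (ys ++ p ∷ ys₁ ++ w ∷ ys₂) q zs (sym (++-assoc ys (p ∷ ys₁ ++ w ∷ ys₂) (q ∷ zs)))
    j = proj₁ at-p
    k = proj₁ at-w
    l = proj₁ at-q
    j<k : toℕ j < toℕ k
    j<k rewrite proj₁ (proj₂ at-p) | proj₁ (proj₂ at-w) = length-< ys
    k<l : toℕ k < toℕ l
    k<l rewrite proj₁ (proj₂ at-w) | proj₁ (proj₂ at-q) =
      subst (λ t → length (ys ++ p ∷ ys₁) < length t) (++-assoc ys (p ∷ ys₁) (w ∷ ys₂)) (length-< (ys ++ p ∷ ys₁))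

  stretch-∈ : ∀ (L : List A) {w B q C v} → v ∈ w ∷ B ++ q ∷ [] → v ∈ L ++ w ∷ B ++ q ∷ C
  stretch-∈ L {w} {B} {q} {C} {v} v∈ =
    ∈-++⁺ʳ L (subst (v ∈_) (cong (w ∷_) (++-assoc B (q ∷ []) C)) (∈-++⁺ˡ v∈))

  unique-++ˡ : ∀ xs {ys : List A} → Unique (xs ++ ys) → Unique xs
  unique-++ˡ []       _        = []
  unique-++ˡ (x ∷ xs) (x∉ ∷ u) = ++⁻ˡ xs x∉ ∷ unique-++ˡ xs u

  unique-++ʳ : ∀ xs {ys : List A} → Unique (xs ++ ys) → Unique ys
  unique-++ʳ []       u       = u
  unique-++ʳ (x ∷ xs) (_ ∷ u) = unique-++ʳ xs u

  unique-disjoint : ∀ xs {ys : List A} → Unique (xs ++ ys) → Disjoint xs ys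
  unique-disjoint (x ∷ xs) (x∉ ∷ u) (here refl , v∈ys) = All¬⇒¬Any x∉ (∈-++⁺ʳ xs v∈ys)
  unique-disjoint (x ∷ xs) (x∉ ∷ u) (there v∈xs , v∈ys) = unique-disjoint xs u (v∈xs , v∈ys)

  unique-reverse : ∀ {xs : List A} → Unique xs → Unique (reverse xs)
  unique-reverse {[]}     u        = []
  unique-reverse {x ∷ xs} (x∉ ∷ u) rewrite unfold-reverse x xs =
    Unique.++⁺ (unique-reverse u) ([] ∷ [])
      λ { (x∈ , here refl) → All¬⇒¬Any x∉ (∈-reverse⁻ x∈) }

  module _ {R : A → A → Set} where

    linked-++ˡ : ∀ xs {ys} → Linked R (xs ++ ys) → Linked R xs
    linked-++ˡ []            _       = []
    linked-++ˡ (x ∷ [])      _       = [-]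
    linked-++ˡ (x ∷ x′ ∷ xs) (r ∷ l) = r ∷ linked-++ˡ (x′ ∷ xs) l

    linked-++ʳ : ∀ xs {ys} → Linked R (xs ++ ys) → Linked R ys
    linked-++ʳ []            l       = l
    linked-++ʳ (x ∷ [])      [-]     = []
    linked-++ʳ (x ∷ [])      (r ∷ l) = l
    linked-++ʳ (x ∷ x′ ∷ xs) (r ∷ l) = linked-++ʳ (x′ ∷ xs) l

    linked-junction : ∀ xs {z ys r} → Linked R (xs ++ z ∷ ys) → last xs ≡ just r → R r z
    linked-junction (x ∷ [])      (e ∷ _) refl = e
    linked-junction (x ∷ x′ ∷ xs) (_ ∷ l) eq   = linked-junction (x′ ∷ xs) l eq

    linked-reverse : (∀ {u v} → R u v → R v u) → ∀ {xs} → Linked R xs → Linked R (reverse xs)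
    linked-reverse R-sym []  = []
    linked-reverse R-sym [-] = [-]
    linked-reverse R-sym {x ∷ y ∷ ys} (r ∷ l) rewrite unfold-reverse x (y ∷ ys) =
      Linked.++⁺ (linked-reverse R-sym l) junction [-]
      where
      junction : Connected R (last (reverse (y ∷ ys))) (just x)
      junction rewrite last-reverse (y ∷ ys) = just (R-sym r)

module _ {A : Set} where

  sum-map-+ : ∀ (f g : A → ℕ) xs → sum (map (λ x → f x + g x) xs) ≡ sum (map f xs) + sum (map g xs)
  sum-map-+ f g []       = refl
  sum-map-+ f g (x ∷ xs) =
    trans (cong (f x + g x +_) (sum-map-+ f g xs)) (+-interchange (f x) (g x) (sum (map f xs)) (sum (map g xs)))

  sum-vanishing : ∀ (f : A → ℕ) xs → (∀ v → v ∈ xs → f v ≡ 0) → sum (map f xs) ≡ 0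
  sum-vanishing f []       _  = refl
  sum-vanishing f (x ∷ xs) f0 rewrite f0 x (here refl) = sum-vanishing f xs (λ v → f0 v ∘ there)

  sum-support₁ : ∀ (f : A → ℕ) {xs w} → Unique xs → w ∈ xs →
                 (∀ v → v ∈ xs → v ≢ w → f v ≡ 0) → sum (map f xs) ≡ f w
  sum-support₁ f {x ∷ xs} (x∉ ∷ _) (here refl) f0 =
    trans (cong (f x +_) (sum-vanishing f xs λ v v∈ → f0 v (there v∈) λ { refl → All¬⇒¬Any x∉ v∈ }))
          (+-identityʳ (f x))
  sum-support₁ f {x ∷ xs} (x∉ ∷ u) (there w∈) f0 =
    trans (cong (_+ sum (map f xs)) (f0 x (here refl) λ { refl → All¬⇒¬Any x∉ w∈ }))
          (sum-support₁ f u w∈ (λ v → f0 v ∘ there))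

  sum-support₂ : ∀ (f : A → ℕ) {xs a b} → Unique xs → a ∈ xs → b ∈ xs → a ≢ b →
                 (∀ v → v ∈ xs → v ≢ a → v ≢ b → f v ≡ 0) → sum (map f xs) ≡ f a + f b
  sum-support₂ f (x∉ ∷ u) (here refl) (here refl)  a≢b f0 = ⊥-elim (a≢b refl)
  sum-support₂ f {x ∷ xs} (x∉ ∷ u) (here refl) (there b∈) a≢b f0 =
    cong (f x +_) (sum-support₁ f u b∈ λ v v∈ → f0 v (there v∈) λ { refl → All¬⇒¬Any x∉ v∈ })
  sum-support₂ f {x ∷ xs} (x∉ ∷ u) (there a∈) (here refl) a≢b f0 =
    trans (cong (f x +_) (sum-support₁ f u a∈ λ v v∈ v≢a → f0 v (there v∈) v≢a λ { refl → All¬⇒¬Any x∉ v∈ }))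
          (+-comm (f x) (f _))
  sum-support₂ f {x ∷ xs} (x∉ ∷ u) (there a∈) (there b∈) a≢b f0 =
    trans (cong (_+ sum (map f xs)) (f0 x (here refl) (λ { refl → All¬⇒¬Any x∉ a∈ }) (λ { refl → All¬⇒¬Any x∉ b∈ })))
          (sum-support₂ f u a∈ b∈ a≢b (λ v → f0 v ∘ there))

module _ {n : ℕ} where

  Σall : (Fin n → ℕ) → ℕ
  Σall f = sum (map f (allFin n))

  Σall-delta : ∀ (g : Fin n → ℕ) w → Σall (λ v → if ⌊ v ≟ w ⌋ then g v else 0) ≡ g w
  Σall-delta g w =
    trans (sum-support₁ _ (Unique.allFin⁺ n) (∈-allFin w) vanish) (at-w w)
    where
    vanish : ∀ v → v ∈ allFin n → v ≢ w → (if ⌊ v ≟ w ⌋ then g v else 0) ≡ 0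
    vanish v _ v≢w with v ≟ w
    ... | yes v≡w = ⊥-elim (v≢w v≡w)
    ... | no _    = refl
    at-w : ∀ w → (if ⌊ w ≟ w ⌋ then g w else 0) ≡ g w
    at-w w with w ≟ w
    ... | yes _   = refl
    ... | no w≢w  = ⊥-elim (w≢w refl)

  vset-∉ : ∀ (L : List (Fin n)) {v} → v ∉ L → vset L v ≡ false
  vset-∉ []      v∉ = refl
  vset-∉ (w ∷ L) {v} v∉ with v ≟ w
  ... | yes refl = ⊥-elim (v∉ (here refl))
  ... | no _     = vset-∉ L (v∉ ∘ there)

  vset-∈ : ∀ (L : List (Fin n)) {v} → v ∈ L → vset L v ≡ true
  vset-∈ (w ∷ L) {v} v∈ with v ≟ w | v∈
  ... | yes _  | _        = refl
  ... | no v≢w | here v≡w = ⊥-elim (v≢w v≡w)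
  ... | no _   | there v∈ = vset-∈ L v∈

  Σall-indicator : ∀ (g : Fin n → ℕ) {L} → Unique L → Σall (λ v → if vset L v then g v else 0) ≡ sum (map g L)
  Σall-indicator g {[]}    _        = sum-vanishing _ (allFin n) (λ _ _ → refl)
  Σall-indicator g {w ∷ L} (w∉ ∷ u) = begin
    Σall (λ v → if vset (w ∷ L) v then g v else 0)  ≡⟨ cong sum (map-cong split (allFin n)) ⟩
    Σall (λ v → at-w v + on-L v)                    ≡⟨ sum-map-+ at-w on-L (allFin n) ⟩
    Σall at-w + Σall on-L                           ≡⟨ cong₂ _+_ (Σall-delta g w) (Σall-indicator g u) ⟩
    g w + sum (map g L)                             ∎
    where
    open ≡-Reasoning
    at-w on-L : Fin n → ℕ
    at-w v = if ⌊ v ≟ w ⌋ then g v else 0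
    on-L v = if vset L v then g v else 0
    -- w ∉ L, so the indicator of w ∷ L splits as that of w plus that of L.
    split : ∀ v → (if vset (w ∷ L) v then g v else 0) ≡ at-w v + on-L v
    split v with v ≟ w
    ... | yes refl rewrite vset-∉ L (All¬⇒¬Any w∉) = sym (+-identityʳ (g v))
    ... | no _     = refl

module _ {n : ℕ} (G : Graph n) where

  edge-sym : ∀ {u v} → Edge G u v → Edge G v u
  edge-sym {u} {v} e = trans (Graph.sym G v u) e

  deg : Fin n → List (Fin n) → ℕ
  deg a W = sum (map (λ b → if adj G a b then 1 else 0) W)

  ‖‖≡Σdeg : ∀ (A : VSet n) {L W} → (∀ v → A v ≡ vset L v) → Unique L → Unique W →
            ‖ A , vset W ‖⟨ G ⟩ ≡ sum (map (λ a → deg a W) L)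
  ‖‖≡Σdeg A {L} {W} A≗L uL uW =
    trans (cong sum (map-cong row (allFin n))) (Σall-indicator (λ a → deg a W) uL)
    where
    row : ∀ a → Σall (λ b → if A a ∧ vset W b ∧ adj G a b then 1 else 0) ≡ (if vset L a then deg a W else 0)
    row a rewrite A≗L a with vset L a
    ... | false = sum-vanishing _ (allFin n) (λ _ _ → refl)
    ... | true  = trans (cong sum (map-cong entry (allFin n))) (Σall-indicator _ uW)
      where
      entry : ∀ b → (if vset W b ∧ adj G a b then 1 else 0) ≡
                    (if vset W b then (if adj G a b then 1 else 0) else 0)
      entry b with vset W b
      ... | true  = refl
      ... | false = refl

  deg-++ : ∀ a xs ys → deg a (xs ++ ys) ≡ deg a xs + deg a ys
  deg-++ a xs ys = trans (cong sum (map-++ _ xs ys)) (sum-++ (map _ xs) (map _ ys))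

  deg-none : ∀ a X → (∀ d → d ∈ X → ¬ Edge G a d) → deg a X ≡ 0
  deg-none a X none = sum-vanishing _ X indicator-zero
    where
    indicator-zero : ∀ d → d ∈ X → (if adj G a d then 1 else 0) ≡ 0
    indicator-zero d d∈ with adj G a d in e
    ... | true  = ⊥-elim (none d d∈ e)
    ... | false = refl

  first-neighbour : ∀ a W {k} → deg a W ≡ suc k →
                    ∃₂ λ A x → ∃ λ R → (W ≡ A ++ x ∷ R) × Edge G a x × (deg a R ≡ k)
  first-neighbour a (w ∷ W) eq with adj G a w in e
  ... | true  = [] , w , W , refl , e , suc-injective eq
  ... | false with first-neighbour a W eq
  ...   | A , x , R , refl , ax , degR = w ∷ A , x , R , refl , ax , degR

  SimplePath : List (Fin n) → Set
  SimplePath P = Unique P × Linked (Edge G) P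

  simple : ∀ {P} → IsPath G P → SimplePath P
  simple p = IsPath.distinct p , IsPath.linked p

  vset-disjoint : ∀ {U W : List (Fin n)} → (∀ v → vset U v ∧ vset W v ≡ false) → Disjoint U W
  vset-disjoint {U} {W} none (v∈U , v∈W) with trans (sym (cong₂ _∧_ (vset-∈ U v∈U) (vset-∈ W v∈W))) (none _)
  ... | ()

  glue : ∀ {xs ys} → SimplePath xs → SimplePath ys → Disjoint xs ys →
         Connected (Edge G) (last xs) (head ys) → SimplePath (xs ++ ys)
  glue (uxs , lxs) (uys , lys) disj junction = Unique.++⁺ uxs uys disj , Linked.++⁺ lxs junction lys

  prefix-path : ∀ xs {ys} → SimplePath (xs ++ ys) → SimplePath xs
  prefix-path xs (u , l) = unique-++ˡ xs u , linked-++ˡ xs l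

  suffix-path : ∀ xs {ys} → SimplePath (xs ++ ys) → SimplePath ys
  suffix-path xs (u , l) = unique-++ʳ xs u , linked-++ʳ xs l

  reverse-path : ∀ {xs} → SimplePath xs → SimplePath (reverse xs)
  reverse-path (u , l) = unique-reverse u , linked-reverse edge-sym l

  -- The fan lemma.  A vertex h off a path a … y … b, adjacent to both ends a, b and to an inner
  -- vertex y, yields the cycle h a … y … b h, in which the edge h–y is a chord.
  fan : ∀ {h a y b} L R → SimplePath (a ∷ L ++ y ∷ R) → h ∉ a ∷ L ++ y ∷ R → last R ≡ just b →
        Edge G h a → Edge G h y → Edge G h b → ChordedCycle G
  fan {h} {a} {y} {b} L (r ∷ R) (uP , lP) h∉P last≡b ha hy hb =
    C , cycle , fzero , j , (λ 0≡j → 2+≢0 (trans (sym j≡) (sym (cong toℕ 0≡j)))) , not-consecutive , chord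
    where
    C : List (Fin n)
    C = h ∷ a ∷ L ++ y ∷ r ∷ R

    length-C : length C ≡ suc (suc (suc (length L))) + suc (length R)
    length-C = cong (suc ∘ suc) (trans (length-++ L) (+-suc (length L) (suc (length R))))

    closing-edge : Σ (Fin (length C)) λ l → (suc (toℕ l) ≡ length C) × Edge G (lookup C l) h
    closing-edge with last-position C (trans (last-++ (h ∷ a ∷ L) (λ ())) last≡b)
    ... | l , l-last , lookup≡b = l , l-last , subst (λ v → Edge G v h) (sym lookup≡b) (edge-sym hb)

    cycle : IsCycle G C
    cycle = record
      { long     = subst (3 ≤_) (sym length-C) (s≤s (s≤s (s≤s z≤n)))
      ; distinct = ¬Any⇒All¬ _ h∉P ∷ uP
      ; linked   = ha ∷ lP
      ; closing  = fzero , proj₁ closing-edge , refl , proj₂ closing-edge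
      }

    -- The chord joins position 0 (h) to position |L| + 2 (y).
    y-position = position (h ∷ a ∷ L) y (r ∷ R) refl

    j : Fin (length C)
    j = proj₁ y-position

    j≡ : toℕ j ≡ suc (suc (length L))
    j≡ = proj₁ (proj₂ y-position)

    2+≢0 : suc (suc (length L)) ≢ 0
    2+≢0 ()

    2+≢1 : suc (suc (length L)) ≢ 1
    2+≢1 ()

    -- Position |L| + 2 is not the last one, since r ∷ R follows y.
    3+≢length : suc (suc (suc (length L))) ≢ length C
    3+≢length eq = m+1+n≢m (suc (suc (suc (length L)))) (sym (trans eq length-C))

    not-consecutive : ¬ CycConsec (length C) 0 (toℕ j)
    not-consecutive (inj₁ j≡1)                      = 2+≢1 (trans (sym j≡) j≡1)
    not-consecutive (inj₂ (inj₂ (inj₁ (_ , j+1≡)))) = 3+≢length (trans (sym (cong suc j≡)) j+1≡)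
    not-consecutive (inj₂ (inj₂ (inj₂ (j≡0 , _))))  = 2+≢0 (trans (sym j≡) j≡0)

    chord : Edge G (lookup C fzero) (lookup C j)
    chord = subst (Edge G h) (sym (proj₂ (proj₂ y-position))) hy

  fan-inner : ∀ {h a y b} M → SimplePath (a ∷ M) → h ∉ a ∷ M → y ∈ M → last M ≡ just b → y ≢ b →
              Edge G h a → Edge G h y → Edge G h b → ChordedCycle G
  fan-inner M pP h∉P y∈M last≡b y≢b ha hy hb with ∈-∃++ y∈M
  ... | L , [] , refl    = ⊥-elim (y≢b (just-injective (trans (sym (last-++ L (λ ()))) last≡b)))
  ... | L , r ∷ R , refl =
    fan L (r ∷ R) pP h∉P (trans (sym (last-++ L (λ ()))) last≡b) ha hy hb

  first-edge : ∀ {x t T} → SimplePath (x ∷ t ∷ T) → Edge G x t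
  first-edge (_ , e ∷ _) = e

  infix-path : ∀ (A S : List (Fin n)) {D} → SimplePath (A ++ S ++ D) → SimplePath S
  infix-path A S p = prefix-path S (suffix-path A p)

  infix-∈ : ∀ (A : List (Fin n)) {S D v} → v ∈ S → v ∈ A ++ S ++ D
  infix-∈ A v∈S = ∈-++⁺ʳ A (∈-++⁺ˡ v∈S)

  junction : ∀ {xs ys u v} → last xs ≡ just u → head ys ≡ just v → Edge G u v →
             Connected (Edge G) (last xs) (head ys)
  junction last≡ head≡ e = subst₂ (Connected (Edge G)) (sym last≡) (sym head≡) (just e)

  path-back : ∀ {t T z} → SimplePath (t ∷ T) → z ∈ t ∷ T →
              ∃ λ Q → SimplePath Q × (head Q ≡ just z) × (last Q ≡ just t) × (∀ {v} → v ∈ Q → v ∈ t ∷ T)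
  path-back {t} {T} {z} p z∈ with ∈-∃++ z∈
  ... | T₁ , T₂ , T≡ =
    reverse (T₁ ++ z ∷ []) ,
    reverse-path (prefix-path (T₁ ++ z ∷ []) (subst SimplePath T≡′ p)) ,
    trans (head-reverse (T₁ ++ z ∷ [])) (last-++ T₁ (λ ())) ,
    trans (last-reverse (T₁ ++ z ∷ [])) (trans (head-++ T₁) (cong head (sym T≡))) ,
    λ v∈ → subst (_ ∈_) (sym T≡′) (∈-++⁺ˡ (∈-reverse⁻ {xs = T₁ ++ z ∷ []} v∈))
    where
    T≡′ : t ∷ T ≡ (T₁ ++ z ∷ []) ++ T₂
    T≡′ = trans T≡ (sym (++-assoc T₁ (z ∷ []) T₂))

  -- A path x … z u … y and a disjoint stretch w … q of W with y ~ w and q ~ x close a cycle;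
  -- cutting it open just before u leaves the path u … y w … q x … (ending before z).
  rotated-path : ∀ {x X z u V y W L w B q C} → SimplePath (x ∷ X ++ z ∷ u ∷ V) → SimplePath W →
                 Disjoint (x ∷ X ++ z ∷ u ∷ V) W → last (u ∷ V) ≡ just y → W ≡ L ++ w ∷ B ++ q ∷ C →
                 Edge G y w → Edge G q x → SimplePath ((u ∷ V) ++ (w ∷ B ++ q ∷ []) ++ x ∷ X)
  rotated-path {x} {X} {z} {u} {V} {y} {W} {L} {w} {B} {q} {C} pU pW apart last-Y W≡ yw qx =
    glue (suffix-path (z ∷ []) (suffix-path X′ pU)) pS++X′ disjoint-Y (junction {Y} {S ++ X′} last-Y refl yw)
    where
    X′ = x ∷ X
    Y  = u ∷ V
    S  = w ∷ B ++ q ∷ []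

    W≡L++S++C : W ≡ L ++ S ++ C
    W≡L++S++C = trans W≡ (cong (λ s → L ++ w ∷ s) (sym (++-assoc B (q ∷ []) C)))

    S⊆W : ∀ {v} → v ∈ S → v ∈ W
    S⊆W v∈S = subst (_ ∈_) (sym W≡) (stretch-∈ L v∈S)

    pS++X′ : SimplePath (S ++ X′)
    pS++X′ = glue (infix-path L S (subst SimplePath W≡L++S++C pW)) (prefix-path X′ pU)
                  (λ (v∈S , v∈X′) → apart (∈-++⁺ˡ v∈X′ , S⊆W v∈S))
                  (junction {S} {X′} (last-++ (w ∷ B) (λ ())) refl qx)

    disjoint-Y : Disjoint Y (S ++ X′)
    disjoint-Y (v∈Y , v∈S++X′) with ∈-++⁻ S v∈S++X′
    ... | inj₁ v∈S  = apart (∈-++⁺ʳ X′ (there v∈Y) , S⊆W v∈S)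
    ... | inj₂ v∈X′ = unique-disjoint X′ (proj₁ pU) (v∈X′ , there v∈Y)

  deg-within : ∀ a A p B q C → (∀ d → d ∈ A ++ p ∷ [] → ¬ Edge G a d) → (∀ d → d ∈ q ∷ C → ¬ Edge G a d) →
               deg a (A ++ p ∷ B ++ q ∷ C) ≡ deg a B
  deg-within a A p B q C before beyond = begin
    deg a (A ++ p ∷ B ++ q ∷ C)                  ≡⟨ cong (deg a) (sym (++-assoc A (p ∷ []) (B ++ q ∷ C))) ⟩
    deg a ((A ++ p ∷ []) ++ B ++ q ∷ C)          ≡⟨ deg-++ a (A ++ p ∷ []) (B ++ q ∷ C) ⟩
    deg a (A ++ p ∷ []) + deg a (B ++ q ∷ C)     ≡⟨ cong₂ _+_ (deg-none a _ before) (deg-++ a B (q ∷ C)) ⟩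
    deg a B + deg a (q ∷ C)                      ≡⟨ cong (deg a B +_) (deg-none a (q ∷ C) beyond) ⟩
    deg a B + 0                                  ≡⟨ +-identityʳ (deg a B) ⟩
    deg a B                                      ∎
    where open ≡-Reasoning

  ‖single‖≡deg : ∀ a {W} → Unique W → ‖ single a , vset W ‖⟨ G ⟩ ≡ deg a W
  ‖single‖≡deg a {W} uW =
    trans (‖‖≡Σdeg (single a) (λ v → sym (∨-identityʳ _)) ([] ∷ []) uW) (+-identityʳ (deg a W))

  ‖pair‖≡deg+deg : ∀ {a b W} → a ≢ b → Unique W → ‖ pair a b , vset W ‖⟨ G ⟩ ≡ deg a W + deg b W
  ‖pair‖≡deg+deg {a} {b} {W} a≢b uW =
    trans (‖‖≡Σdeg (pair a b) (λ v → cong (⌊ v ≟ a ⌋ ∨_) (sym (∨-identityʳ _))) ((a≢b ∷ []) ∷ [] ∷ []) uW)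
          (cong (deg a W +_) (+-identityʳ (deg b W)))

  straddle : ∀ {a b} A p B₁ w B₂ q C → let W = A ++ p ∷ (B₁ ++ w ∷ B₂) ++ q ∷ C in
             Unique W → deg a W ≡ 2 → deg b W ≡ 1 → Edge G a p → Edge G b w → Edge G a q → Straddle G a b W
  straddle {a} {b} A p B₁ w B₂ q C uW deg-a deg-b ap bw aq
    with ordered-positions A p B₁ w B₂ q C refl
  ... | j , k , l , j<k , k<l , at-j , at-k , at-l =
    trans (‖single‖≡deg a uW) deg-a , trans (‖single‖≡deg b uW) deg-b , j , k , l , j<k , k<l ,
    subst (Edge G a) (sym at-j) ap , subst (Edge G b) (sym at-k) bw , subst (Edge G a) (sym at-l) aq

  ‖pair-same‖≡deg : ∀ a {W} → Unique W → ‖ pair a a , vset W ‖⟨ G ⟩ ≡ deg a W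
  ‖pair-same‖≡deg a {W} uW =
    trans (‖‖≡Σdeg (pair a a) (λ v → trans (∨-idem _) (sym (∨-identityʳ _))) ([] ∷ []) uW) (+-identityʳ (deg a W))

  record PathOff (U : List (Fin n)) (x y : Fin n) (W : List (Fin n)) : Set where
    field
      tail  : List (Fin n)
      shape : U ≡ x ∷ tail
      path  : SimplePath (x ∷ tail)
      ends  : last tail ≡ just y
      apart : Disjoint (x ∷ tail) W

  orient : ∀ {U W x y} → SimplePath U → Disjoint U W → head U ≡ just x → last U ≡ just y → x ≢ y → PathOff U x y W
  orient {x ∷ []}    pU apart refl refl x≢y = ⊥-elim (x≢y refl)
  orient {x ∷ t ∷ T} pU apart refl ends x≢y =
    record { tail = t ∷ T ; shape = refl ; path = pU ; ends = ends ; apart = apart }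

  orient-reverse : ∀ {U W x y} → SimplePath U → Disjoint U W → head U ≡ just x → last U ≡ just y → x ≢ y →
                   PathOff (reverse U) y x W
  orient-reverse {U} pU apart head≡ last≡ x≢y =
    orient (reverse-path pU) (λ (v∈ , v∈W) → apart (∈-reverse⁻ v∈ , v∈W))
           (trans (head-reverse U) last≡) (trans (last-reverse U) head≡) (x≢y ∘ sym)

at-most-three : ∀ a b → a ≤ 2 → b ≤ 2 → (a ≡ 2 → b ≡ 2 → ⊥) →
                (a + b ≤ 3) × (a + b ≡ 3 → (a ≡ 2 × b ≡ 1) ⊎ (a ≡ 1 × b ≡ 2))
at-most-three 0 0 _ _ _       = z≤n , λ ()
at-most-three 0 1 _ _ _       = s≤s z≤n , λ ()
at-most-three 0 2 _ _ _       = s≤s (s≤s z≤n) , λ ()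
at-most-three 1 0 _ _ _       = s≤s z≤n , λ ()
at-most-three 1 1 _ _ _       = s≤s (s≤s z≤n) , λ ()
at-most-three 1 2 _ _ _       = ≤-refl , λ _ → inj₂ (refl , refl)
at-most-three 2 0 _ _ _       = s≤s (s≤s z≤n) , λ ()
at-most-three 2 1 _ _ _       = ≤-refl , λ _ → inj₁ (refl , refl)
at-most-three 2 2 _ _ not-2-2 = ⊥-elim (not-2-2 refl refl)
at-most-three (suc (suc (suc a))) b (s≤s (s≤s ())) _ _
at-most-three a (suc (suc (suc b))) _ (s≤s (s≤s ())) _

module NoChordedCycle {n : ℕ} {G : Graph n} (noCC : ¬ ChordedCycle G) where

  -- A vertex off a path has at most two neighbours on it: with three, the fan lemma applies
  -- to the sub-path between the first and the third.
  deg≤2 : ∀ {h W} → SimplePath G W → h ∉ W → deg G h W ≤ 2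
  deg≤2 {h} {W} pW h∉W with deg G h W in deg≡
  ... | 0 = z≤n
  ... | 1 = s≤s z≤n
  ... | 2 = s≤s (s≤s z≤n)
  ... | suc (suc (suc k)) with first-neighbour G h W deg≡
  ...   | A , x₁ , R₁ , refl , hx₁ , deg₁ with first-neighbour G h R₁ deg₁
  ...     | B , x₂ , R₂ , refl , hx₂ , deg₂ with first-neighbour G h R₂ deg₂
  ...       | C , x₃ , D , refl , hx₃ , _ =
    ⊥-elim (noCC (fan G B (C ++ x₃ ∷ []) (infix-path G A S (subst (SimplePath G) W≡ pW))
                      (λ h∈S → h∉W (subst (h ∈_) (sym W≡) (infix-∈ G A h∈S)))
                      (last-++ C (λ ())) hx₁ hx₂ hx₃))
    where
    S = x₁ ∷ B ++ x₂ ∷ C ++ x₃ ∷ []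
    W≡ : A ++ x₁ ∷ B ++ x₂ ∷ C ++ x₃ ∷ D ≡ A ++ S ++ D
    W≡ = cong (λ t → A ++ x₁ ∷ t)
              (sym (trans (++-assoc B (x₂ ∷ C ++ x₃ ∷ []) D) (cong (λ t → B ++ x₂ ∷ t) (++-assoc C (x₃ ∷ []) D))))

  -- Let x see p and q, in this order on W.  Then no vertex z of T sees a vertex d of W at or beyond q:
  -- otherwise p … q … d z … t (back along T) is a path whose ends p, t and inner vertex q are adjacent to x.
  beyond-span : ∀ {x T W A p B q C z d} → SimplePath G (x ∷ T) → SimplePath G W → Disjoint (x ∷ T) W →
                W ≡ A ++ p ∷ B ++ q ∷ C → Edge G x p → Edge G x q → z ∈ T → d ∈ q ∷ C → ¬ Edge G z d
  beyond-span {x} {t ∷ T} {W} {A} {p} {B} {q} {C} {z} {d} pU pW apart W≡ xp xq z∈T d∈ zd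
    with up-to d∈ | path-back G (suffix-path G (x ∷ []) pU) z∈T
  ... | C₁ , C₂ , refl , last-q∷C₁ | Q , pQ , head-Q , last-Q , Q⊆T =
    noCC (fan-inner G M (glue G pS pQ disjoint-S-Q (junction G {S} {Q} last-S head-Q (edge-sym G zd)))
                    x∉S++Q q∈M last-M q≢t xp xq (first-edge G pU))
    where
    S = p ∷ B ++ q ∷ C₁
    M = (B ++ q ∷ C₁) ++ Q

    last-S : last S ≡ just d
    last-S = trans (last-++ (p ∷ B) (λ ())) last-q∷C₁

    W≡A++S++C₂ : W ≡ A ++ S ++ C₂
    W≡A++S++C₂ = trans W≡ (cong (λ s → A ++ p ∷ s) (sym (++-assoc B (q ∷ C₁) C₂)))

    pS : SimplePath G S
    pS = infix-path G A S (subst (SimplePath G) W≡A++S++C₂ pW)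

    S⊆W : ∀ {v} → v ∈ S → v ∈ W
    S⊆W v∈S = subst (_ ∈_) (sym W≡A++S++C₂) (infix-∈ G A v∈S)

    disjoint-S-Q : Disjoint S Q
    disjoint-S-Q (v∈S , v∈Q) = apart (there (Q⊆T v∈Q) , S⊆W v∈S)

    x∉S++Q : x ∉ S ++ Q
    x∉S++Q x∈ with ∈-++⁻ S x∈
    ... | inj₁ x∈S = apart (here refl , S⊆W x∈S)
    ... | inj₂ x∈Q = Unique[x∷xs]⇒x∉xs (proj₁ pU) (Q⊆T x∈Q)

    q∈M : q ∈ M
    q∈M = ∈-++⁺ˡ (∈-++⁺ʳ B (here refl))

    last-M : last M ≡ just t
    last-M = trans (last-++ (B ++ q ∷ C₁) (head⇒≢[] head-Q)) last-Q

    q≢t : q ≢ t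
    q≢t refl = apart (there (here refl) , S⊆W (∈-++⁺ʳ (p ∷ B) (here refl)))

  before-span : ∀ {x T W A p B q C z d} → SimplePath G (x ∷ T) → SimplePath G W → Disjoint (x ∷ T) W →
                W ≡ A ++ p ∷ B ++ q ∷ C → Edge G x p → Edge G x q → z ∈ T → d ∈ A ++ p ∷ [] → ¬ Edge G z d
  before-span {A = A} {p} {B} {q} {C} {d = d} pU pW apart W≡ xp xq z∈T d∈ =
    beyond-span pU (reverse-path G pW) (λ (v∈U , v∈W) → apart (v∈U , ∈-reverse⁻ v∈W))
                (trans (cong reverse W≡) (reverse-split₂ A p B q C)) xq xp z∈T
                (subst (d ∈_) (reverse-split A p []) (∈-reverse⁺ d∈))

  confined : ∀ {x T W A p B q C z} → SimplePath G (x ∷ T) → SimplePath G W → Disjoint (x ∷ T) W →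
             W ≡ A ++ p ∷ B ++ q ∷ C → Edge G x p → Edge G x q → z ∈ T → deg G z W ≡ deg G z B
  confined {A = A} {p} {B} {q} {C} {z} pU pW apart W≡ xp xq z∈T =
    trans (cong (deg G z) W≡)
          (deg-within G z A p B q C (λ d → before-span pU pW apart W≡ xp xq z∈T)
                                    (λ d → beyond-span pU pW apart W≡ xp xq z∈T))

  -- Let U = x ∷ X ++ z ∷ u ∷ V end at y, and let a stretch w … q of W join y back to x (y ~ w, q ~ x).
  -- Then z sees no vertex d of the stretch before q: the rotated path u … y w … q x … r, with r the
  -- vertex preceding z on U, has ends u, r and inner vertex d, all adjacent to z.
  chord-free : ∀ {x X z u V y W L w B q C d} → SimplePath G (x ∷ X ++ z ∷ u ∷ V) → SimplePath G W →
               Disjoint (x ∷ X ++ z ∷ u ∷ V) W → last (u ∷ V) ≡ just y → W ≡ L ++ w ∷ B ++ q ∷ C →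
               Edge G y w → Edge G q x → d ∈ w ∷ B → ¬ Edge G z d
  chord-free {x} {X} {z} {u} {V} {y} {W} {L} {w} {B} {q} {C} {d} pU pW apart last-Y W≡ yw qx d∈ zd
    with last-exists x X
  ... | r , last-X′ =
    noCC (fan-inner G M (rotated-path G pU pW apart last-Y W≡ yw qx) z∉P d∈M last-M d≢r
                    (first-edge G (suffix-path G (x ∷ X) pU)) zd
                    (edge-sym G (linked-junction (x ∷ X) (proj₂ pU) last-X′)))
    where
    X′ = x ∷ X
    S  = w ∷ B ++ q ∷ []
    M  = V ++ S ++ X′

    S⊆W : ∀ {v} → v ∈ S → v ∈ W
    S⊆W v∈S = subst (_ ∈_) (sym W≡) (stretch-∈ L v∈S)

    z∉P : z ∉ (u ∷ V) ++ S ++ X′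
    z∉P z∈ with ∈-++⁻ (u ∷ V) z∈
    ... | inj₁ z∈Y = Unique[x∷xs]⇒x∉xs (unique-++ʳ X′ (proj₁ pU)) z∈Y
    ... | inj₂ z∈S++X′ with ∈-++⁻ S z∈S++X′
    ...   | inj₁ z∈S  = apart (∈-++⁺ʳ X′ (here refl) , S⊆W z∈S)
    ...   | inj₂ z∈X′ = unique-disjoint X′ (proj₁ pU) (z∈X′ , here refl)

    d∈M : d ∈ M
    d∈M = ∈-++⁺ʳ V (∈-++⁺ˡ (∈-++⁺ˡ {ys = q ∷ []} d∈))

    last-M : last M ≡ just r
    last-M = trans (last-++ V (λ ())) (trans (last-++ S (λ ())) last-X′)

    d≢r : d ≢ r
    d≢r refl = apart (∈-++⁺ˡ {xs = X′} (last∈ last-X′) , S⊆W (∈-++⁺ˡ d∈))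

  interior-silent : ∀ {U x y W A p B₁ w B₂ q C} → PathOff G U x y W → SimplePath G W →
                    W ≡ A ++ p ∷ (B₁ ++ w ∷ B₂) ++ q ∷ C → Edge G x p → Edge G x q → Edge G y w →
                    ∀ z → z ∈ U → z ≢ x → z ≢ y → deg G z W ≡ 0
  interior-silent record { shape = refl } _ _ _ _ _ z (here refl) z≢x _ = ⊥-elim (z≢x refl)
  interior-silent {W = W} {A} {p} {B₁} {w} {B₂} {q} {C}
    record { tail = T ; shape = refl ; path = pU ; ends = ends ; apart = apart }
    pW W≡ xp xq yw z (there z∈T) _ z≢y
    with interior-split z∈T ends z≢y
  ... | X , u , V , refl , last-Y =
    trans (confined pU pW apart W≡ xp xq z∈T) (deg-none G z (B₁ ++ w ∷ B₂) no-chord)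
    where
    W≡at-w : W ≡ (A ++ p ∷ B₁) ++ w ∷ B₂ ++ q ∷ C
    W≡at-w = trans W≡ (trans (cong (λ s → A ++ p ∷ s) (++-assoc B₁ (w ∷ B₂) (q ∷ C)))
                            (sym (++-assoc A (p ∷ B₁) (w ∷ B₂ ++ q ∷ C))))
    reverse-W≡ : reverse W ≡ reverse (B₂ ++ q ∷ C) ++ w ∷ reverse B₁ ++ p ∷ reverse A
    reverse-W≡ = trans (cong reverse W≡at-w)
                       (trans (reverse-split (A ++ p ∷ B₁) w (B₂ ++ q ∷ C))
                              (cong (λ s → reverse (B₂ ++ q ∷ C) ++ w ∷ s) (reverse-split A p B₁)))
    no-chord : ∀ d → d ∈ B₁ ++ w ∷ B₂ → ¬ Edge G z d
    no-chord d d∈ with ∈-++⁻ B₁ d∈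
    ... | inj₂ d∈w∷B₂ = chord-free pU pW apart last-Y W≡at-w yw (edge-sym G xq) d∈w∷B₂
    ... | inj₁ d∈B₁   = chord-free pU (reverse-path G pW) (λ (v∈ , v∈W) → apart (v∈ , ∈-reverse⁻ v∈W))
                                   last-Y reverse-W≡ yw (edge-sym G xp) (there (∈-reverse⁺ d∈B₁))

  two-one : ∀ {U x y W} → PathOff G U x y W → SimplePath G W → deg G x W ≡ 2 → deg G y W ≡ 1 →
            Straddle G x y W × (∀ z → z ∈ U → z ≢ x → z ≢ y → deg G z W ≡ 0)
  two-one {x = x} {y} {W} P pW deg-x deg-y with first-neighbour G x W deg-x
  ... | A , p , R , refl , xp , deg-R with first-neighbour G x R deg-R
  ...   | B , q , C , refl , xq , _ with first-neighbour G y B deg-y-B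
    where
    deg-y-B : deg G y B ≡ 1
    deg-y-B = trans (sym (confined (PathOff.path P) pW (PathOff.apart P) refl xp xq (last∈ (PathOff.ends P))))
                    deg-y
  ...     | B₁ , w , B₂ , refl , yw , _ =
    straddle G A p B₁ w B₂ q C (proj₁ pW) deg-x deg-y xp yw xq , interior-silent P pW refl xp xq yw

  -- The two ends of U cannot both have two neighbours on W: the two neighbours r, s of y lie
  -- between those p, q of x, so x would see q beyond the span of y (beyond-span, U reversed).
  not-both-two : ∀ {U U′ x y W} → PathOff G U x y W → PathOff G U′ y x W → SimplePath G W →
                 deg G x W ≡ 2 → deg G y W ≡ 2 → ⊥
  not-both-two {x = x} {y} {W} P P′ pW deg-x deg-y with first-neighbour G x W deg-x
  ... | A , p , R , refl , xp , deg-R with first-neighbour G x R deg-R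
  ...   | B , q , C , refl , xq , _ with first-neighbour G y B deg-y-B
    where
    deg-y-B : deg G y B ≡ 2
    deg-y-B = trans (sym (confined (PathOff.path P) pW (PathOff.apart P) refl xp xq (last∈ (PathOff.ends P))))
                    deg-y
  ...     | B₁ , r , R₁ , refl , yr , deg-R₁ with first-neighbour G y R₁ deg-R₁
  ...       | B₂ , s , B₃ , refl , ys , _ =
    beyond-span (PathOff.path P′) pW (PathOff.apart P′) W≡ yr ys (last∈ (PathOff.ends P′))
                (there (∈-++⁺ʳ B₃ (here refl))) xq
    where
    W≡ : A ++ p ∷ (B₁ ++ r ∷ B₂ ++ s ∷ B₃) ++ q ∷ C ≡ (A ++ p ∷ B₁) ++ r ∷ B₂ ++ s ∷ B₃ ++ q ∷ C
    W≡ = trans (cong (λ t → A ++ p ∷ t) (trans (++-assoc B₁ (r ∷ B₂ ++ s ∷ B₃) (q ∷ C))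
                                                (cong (λ t → B₁ ++ r ∷ t) (++-assoc B₂ (s ∷ B₃) (q ∷ C)))))
               (sym (++-assoc A (p ∷ B₁) (r ∷ B₂ ++ s ∷ B₃ ++ q ∷ C)))

  one-end : ∀ {u W} → SimplePath G W → u ∉ W →
            (‖ pair u u , vset W ‖⟨ G ⟩ ≤ 3) × (‖ pair u u , vset W ‖⟨ G ⟩ ≢ 3)
  one-end {u} {W} pW u∉W rewrite ‖pair-same‖≡deg G u (proj₁ pW) =
    m≤n⇒m≤1+n (deg≤2 pW u∉W) , λ deg≡3 → 3≰2 (subst (_≤ 2) deg≡3 (deg≤2 pW u∉W))
    where
    3≰2 : ¬ 3 ≤ 2
    3≰2 (s≤s (s≤s ()))

  two-ends : ∀ {U W x y} → SimplePath G U → SimplePath G W → Disjoint U W →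
             head U ≡ just x → last U ≡ just y → x ≢ y →
             (‖ pair x y , vset W ‖⟨ G ⟩ ≤ 3) ×
             (‖ pair x y , vset W ‖⟨ G ⟩ ≡ 3 →
               (Straddle G x y W ⊎ Straddle G y x W) × (‖ vset U , vset W ‖⟨ G ⟩ ≡ 3))
  two-ends {U} {W} {x} {y} pU pW apart head≡ last≡ x≢y =
    subst (_≤ 3) (sym ‖pair‖) (proj₁ bound) , λ ‖pair‖≡3 → equality (proj₂ bound (trans (sym ‖pair‖) ‖pair‖≡3))
    where
    P  = orient G pU apart head≡ last≡ x≢y
    P′ = orient-reverse G pU apart head≡ last≡ x≢y
    x∈U = head∈ head≡
    y∈U = last∈ last≡

    ‖pair‖ : ‖ pair x y , vset W ‖⟨ G ⟩ ≡ deg G x W + deg G y W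
    ‖pair‖ = ‖pair‖≡deg+deg G x≢y (proj₁ pW)

    bound = at-most-three (deg G x W) (deg G y W) (deg≤2 pW (λ x∈W → apart (x∈U , x∈W)))
                          (deg≤2 pW (λ y∈W → apart (y∈U , y∈W))) (not-both-two P P′ pW)

    ‖U,W‖ : (∀ z → z ∈ U → z ≢ x → z ≢ y → deg G z W ≡ 0) → ‖ vset U , vset W ‖⟨ G ⟩ ≡ deg G x W + deg G y W
    ‖U,W‖ silent = trans (‖‖≡Σdeg G (vset U) (λ _ → refl) (proj₁ pU) (proj₁ pW))
                         (sum-support₂ (λ a → deg G a W) (proj₁ pU) x∈U y∈U x≢y silent)

    equality : (deg G x W ≡ 2 × deg G y W ≡ 1) ⊎ (deg G x W ≡ 1 × deg G y W ≡ 2) →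
               (Straddle G x y W ⊎ Straddle G y x W) × (‖ vset U , vset W ‖⟨ G ⟩ ≡ 3)
    equality (inj₁ (deg-x , deg-y)) with two-one P pW deg-x deg-y
    ... | straddles , silent = inj₁ straddles , trans (‖U,W‖ silent) (cong₂ _+_ deg-x deg-y)
    equality (inj₂ (deg-x , deg-y)) with two-one P′ pW deg-y deg-x
    ... | straddles , silent =
      inj₂ straddles , trans (‖U,W‖ λ z z∈U z≢x z≢y → silent z (∈-reverse⁺ z∈U) z≢y z≢x) (cong₂ _+_ deg-x deg-y)

open NoChordedCycle using (one-end; two-ends)

lemma17 : ∀ {n} (G : Graph n) → ¬ ChordedCycle G →
    (U W : List (Fin n)) → IsPath G U → IsPath G W →
    (∀ v → vset U v Data.Bool.∧ vset W v ≡ Data.Bool.false) →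
    (u₁ u₂ : Fin n) → head U ≡ just u₁ → last U ≡ just u₂ →
    (‖ pair u₁ u₂ , vset W ‖⟨ G ⟩ ≤ 3) ×
    (‖ pair u₁ u₂ , vset W ‖⟨ G ⟩ ≡ 3 →
    (u₁ ≢ u₂) × (Straddle G u₁ u₂ W ⊎ Straddle G u₂ u₁ W) ×
    (‖ vset U , vset W ‖⟨ G ⟩ ≡ 3))
lemma17 G noCC U W pathU pathW vsets-disjoint u₁ u₂ head≡ last≡ with u₁ ≟ u₂
... | yes refl = proj₁ bound , λ ‖pair‖≡3 → ⊥-elim (proj₂ bound ‖pair‖≡3)
  where
  bound = one-end noCC (simple G pathW) (λ u₁∈W → vset-disjoint G vsets-disjoint (head∈ head≡ , u₁∈W))
... | no u₁≢u₂ = proj₁ bound , λ ‖pair‖≡3 → u₁≢u₂ , proj₂ bound ‖pair‖≡3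
  where
  bound = two-ends noCC (simple G pathU) (simple G pathW) (vset-disjoint G vsets-disjoint) head≡ last≡ u₁≢u₂
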